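{- Let $H$ be a two-terminal series-parallel graph in the generalized sense described in the context, with poles $a$ and $b$. Then $N_H(a)\cap N_H(b)$ is an independent set of $H$.
   Context: A two-terminal graph is a graph with two distinguished vertices called poles. Two-terminal series-parallel graphs (generalized sense) are defined recursively: a graph on exactly two vertices, which are its poles, either joined by an edge or not, is one. If $G_1$ has poles $u_1,v_1$ and $G_2$ has poles $u_2,v_2$ (vertex-disjoint copies), their serial join $S(G_1,G_2)$ is obtained by identifying $v_1$ with $u_2$, with poles $u_1$ and $v_2$; their parallel join $P(G_1,G_2)$ is obtained by identifying $u_1$ with $u_2$ and $v_1$ with $v_2$, with the two identified vertices as poles (parallel edges are merged, so the result is simple). Every graph obtainable from the two-vertex graphs by finitely many serial and parallel joins, with the resulting poles, is such a graph. $N_H(x)$ denotes the set of neighbors of $x$ in $H$. -}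

module Defs where

open import Data.Bool using (Bool; true; false)
open import Data.Empty using (⊥)
open import Data.Unit using (⊤; tt)
open import Data.Sum using (_⊎_; inj₁; inj₂)
open import Data.Product using (Σ; _×_; _,_; ∃-syntax)
open import Relation.Binary.PropositionalEquality using (_≡_)
open import Relation.Nullary using (¬_)

-- Construction trees of two-terminal series-parallel graphs (generalized sense).
--   base e   : the graph on exactly two vertices (its poles), with an edge iff e ≡ true
--   ser G H  : the serial join S(G,H)
--   par G H  : the parallel join P(G,H)
data SP : Set where
  base : Bool → SP
  ser  : SP → SP → SP
  par  : SP → SP → SP

Inner : SP → Set
Inner (base _)  = ⊥
Inner (ser g h) = (Inner g ⊎ Inner h) ⊎ ⊤   -- inj₂ tt : the identified vertex v₁ = u₂
Inner (par g h) = Inner g ⊎ Inner h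

data Vtx (t : SP) : Set where
  pa  : Vtx t
  pb  : Vtx t
  inn : Inner t → Vtx t

serL : (g h : SP) → Vtx g → Vtx (ser g h)
serL g h pa      = pa
serL g h pb      = inn (inj₂ tt)
serL g h (inn i) = inn (inj₁ (inj₁ i))

serR : (g h : SP) → Vtx h → Vtx (ser g h)
serR g h pa      = inn (inj₂ tt)
serR g h pb      = pb
serR g h (inn i) = inn (inj₁ (inj₂ i))

parL : (g h : SP) → Vtx g → Vtx (par g h)
parL g h pa      = pa
parL g h pb      = pb
parL g h (inn i) = inn (inj₁ i)

parR : (g h : SP) → Vtx h → Vtx (par g h)
parR g h pa      = pa
parR g h pb      = pb
parR g h (inn i) = inn (inj₂ i)

-- Adjacency in the (simple) graph built by a construction tree:
-- an edge of the join is the image of an edge of one of the components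
-- (parallel edges are merged automatically, since adjacency is a relation).
Adj : (t : SP) → Vtx t → Vtx t → Set
Adj (base e) pa pb = e ≡ true
Adj (base e) pb pa = e ≡ true
Adj (base e) _  _  = ⊥
Adj (ser g h) x y =
    (∃[ x' ] ∃[ y' ] (serL g h x' ≡ x × serL g h y' ≡ y × Adj g x' y'))
  ⊎ (∃[ x' ] ∃[ y' ] (serR g h x' ≡ x × serR g h y' ≡ y × Adj h x' y'))
Adj (par g h) x y =
    (∃[ x' ] ∃[ y' ] (parL g h x' ≡ x × parL g h y' ≡ y × Adj g x' y'))
  ⊎ (∃[ x' ] ∃[ y' ] (parR g h x' ≡ x × parR g h y' ≡ y × Adj h x' y'))

N : (t : SP) → Vtx t → Vtx t → Set
N t x y = Adj t x y

_∩_ : {A : Set} → (A → Set) → (A → Set) → A → Set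
(P ∩ Q) x = P x × Q x

Independent : (t : SP) → (Vtx t → Set) → Set
Independent t S = ∀ x y → S x → S y → ¬ Adj t x y

-- Adjacency in a join is inherited from the components, and the embeddings of
-- the components are injective, so the graph is loopless. In a serial join every
-- neighbour of the first pole lies in the left component and every neighbour of
-- the second pole in the right one; the two share only the junction vertex, so
-- the poles have at most one common neighbour. In a parallel join a common
-- neighbour of the poles is an inner vertex of one component, where it is already
-- a common neighbour of that component's poles, and an edge between two such
-- vertices lies in one component, so induction applies.
module Submission where

open import Defs
open import Data.Empty using (⊥-elim)
open import Data.Sum using (inj₁; inj₂)
open import Data.Unit using (tt)
open import Data.Product using (_,_; ∃-syntax)
open import Function.Definitions using (Injective)
open import Relation.Binary.PropositionalEquality using (_≡_; refl; sym; cong; subst; subst₂)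
open import Relation.Nullary using (¬_)

CommonNeighbour : (t : SP) → Vtx t → Set
CommonNeighbour t = N t pa ∩ N t pb

module _ {g h : SP} where

  serL-injective : Injective _≡_ _≡_ (serL g h)
  serL-injective {pa}    {pa}    _    = refl
  serL-injective {pb}    {pb}    _    = refl
  serL-injective {inn i} {inn i} refl = refl
  serL-injective {pa}    {pb}    ()
  serL-injective {pa}    {inn _} ()
  serL-injective {pb}    {pa}    ()
  serL-injective {pb}    {inn _} ()
  serL-injective {inn _} {pa}    ()
  serL-injective {inn _} {pb}    ()

  serR-injective : Injective _≡_ _≡_ (serR g h)
  serR-injective {pa}    {pa}    _    = refl
  serR-injective {pb}    {pb}    _    = refl
  serR-injective {inn i} {inn i} refl = refl
  serR-injective {pa}    {pb}    ()
  serR-injective {pa}    {inn _} ()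
  serR-injective {pb}    {pa}    ()
  serR-injective {pb}    {inn _} ()
  serR-injective {inn _} {pa}    ()
  serR-injective {inn _} {pb}    ()

  parL-injective : Injective _≡_ _≡_ (parL g h)
  parL-injective {pa}    {pa}    _    = refl
  parL-injective {pb}    {pb}    _    = refl
  parL-injective {inn i} {inn i} refl = refl
  parL-injective {pa}    {pb}    ()
  parL-injective {pa}    {inn _} ()
  parL-injective {pb}    {pa}    ()
  parL-injective {pb}    {inn _} ()
  parL-injective {inn _} {pa}    ()
  parL-injective {inn _} {pb}    ()

  parR-injective : Injective _≡_ _≡_ (parR g h)
  parR-injective {pa}    {pa}    _    = refl
  parR-injective {pb}    {pb}    _    = refl
  parR-injective {inn i} {inn i} refl = refl
  parR-injective {pa}    {pb}    ()
  parR-injective {pa}    {inn _} ()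
  parR-injective {pb}    {pa}    ()
  parR-injective {pb}    {inn _} ()
  parR-injective {inn _} {pa}    ()
  parR-injective {inn _} {pb}    ()

  serL≡serR⇒pb : ∀ {u v} → serL g h u ≡ serR g h v → u ≡ pb
  serL≡serR⇒pb {pb}    _  = refl
  serL≡serR⇒pb {pa}    {pa}    ()
  serL≡serR⇒pb {pa}    {pb}    ()
  serL≡serR⇒pb {pa}    {inn _} ()
  serL≡serR⇒pb {inn _} {pa}    ()
  serL≡serR⇒pb {inn _} {pb}    ()
  serL≡serR⇒pb {inn _} {inn _} ()

  ser-pa-neighbour-left : ∀ {x} → Adj (ser g h) pa x → ∃[ x′ ] serL g h x′ ≡ x
  ser-pa-neighbour-left (inj₁ (_ , y , _ , e , _)) = y , e
  ser-pa-neighbour-left (inj₂ (pa    , _ , () , _))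
  ser-pa-neighbour-left (inj₂ (pb    , _ , () , _))
  ser-pa-neighbour-left (inj₂ (inn _ , _ , () , _))

  ser-pb-neighbour-right : ∀ {x} → Adj (ser g h) pb x → ∃[ x′ ] serR g h x′ ≡ x
  ser-pb-neighbour-right (inj₂ (_ , y , _ , e , _)) = y , e
  ser-pb-neighbour-right (inj₁ (pa    , _ , () , _))
  ser-pb-neighbour-right (inj₁ (pb    , _ , () , _))
  ser-pb-neighbour-right (inj₁ (inn _ , _ , () , _))

  ser-common-neighbour≡junction : ∀ {x} → CommonNeighbour (ser g h) x → x ≡ inn (inj₂ tt)
  ser-common-neighbour≡junction (a , b)
    with ser-pa-neighbour-left a | ser-pb-neighbour-right b
  ... | u , refl | _ , e = cong (serL g h) (serL≡serR⇒pb (sym e))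

  parL-reflects-Adj : ∀ {u i} → Adj (par g h) (parL g h u) (inn (inj₁ i)) → Adj g u (inn i)
  parL-reflects-Adj (inj₁ (_ , inn _ , e , refl , a)) = subst (λ z → Adj g z _) (parL-injective e) a
  parL-reflects-Adj (inj₁ (_ , pa , _ , () , _))
  parL-reflects-Adj (inj₁ (_ , pb , _ , () , _))
  parL-reflects-Adj (inj₂ (_ , pa , _ , () , _))
  parL-reflects-Adj (inj₂ (_ , pb , _ , () , _))
  parL-reflects-Adj (inj₂ (_ , inn _ , _ , () , _))

  parR-reflects-Adj : ∀ {u i} → Adj (par g h) (parR g h u) (inn (inj₂ i)) → Adj h u (inn i)
  parR-reflects-Adj (inj₂ (_ , inn _ , e , refl , a)) = subst (λ z → Adj h z _) (parR-injective e) a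
  parR-reflects-Adj (inj₂ (_ , pa , _ , () , _))
  parR-reflects-Adj (inj₂ (_ , pb , _ , () , _))
  parR-reflects-Adj (inj₁ (_ , pa , _ , () , _))
  parR-reflects-Adj (inj₁ (_ , pb , _ , () , _))
  parR-reflects-Adj (inj₁ (_ , inn _ , _ , () , _))

Adj-irrefl : ∀ t x → ¬ Adj t x x
Adj-irrefl (base _)  pa       ()
Adj-irrefl (base _)  pb       ()
Adj-irrefl (base _)  (inn ())
Adj-irrefl (ser g h) _ (inj₁ (x , _ , refl , e , a)) = Adj-irrefl g x (subst (Adj g x) (serL-injective e) a)
Adj-irrefl (ser g h) _ (inj₂ (x , _ , refl , e , a)) = Adj-irrefl h x (subst (Adj h x) (serR-injective e) a)
Adj-irrefl (par g h) _ (inj₁ (x , _ , refl , e , a)) = Adj-irrefl g x (subst (Adj g x) (parL-injective e) a)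
Adj-irrefl (par g h) _ (inj₂ (x , _ , refl , e , a)) = Adj-irrefl h x (subst (Adj h x) (parR-injective e) a)

subsingleton-independent : ∀ t {S : Vtx t → Set} v → (∀ {x} → S x → x ≡ v) → Independent t S
subsingleton-independent t v ≡v x y sx sy a = Adj-irrefl t v (subst₂ (Adj t) (≡v sx) (≡v sy) a)

module _ {g h : SP} where

  parL-common-neighbour : ∀ x → CommonNeighbour (par g h) (parL g h x) → CommonNeighbour g x
  parL-common-neighbour pa      (a , _) = ⊥-elim (Adj-irrefl (par g h) pa a)
  parL-common-neighbour pb      (_ , b) = ⊥-elim (Adj-irrefl (par g h) pb b)
  parL-common-neighbour (inn _) (a , b) = parL-reflects-Adj a , parL-reflects-Adj b

  parR-common-neighbour : ∀ x → CommonNeighbour (par g h) (parR g h x) → CommonNeighbour h x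
  parR-common-neighbour pa      (a , _) = ⊥-elim (Adj-irrefl (par g h) pa a)
  parR-common-neighbour pb      (_ , b) = ⊥-elim (Adj-irrefl (par g h) pb b)
  parR-common-neighbour (inn _) (a , b) = parR-reflects-Adj a , parR-reflects-Adj b

lemma2p4 : (H : SP) → Independent H (N H pa ∩ N H pb)
lemma2p4 (base _) pa       _ (() , _)
lemma2p4 (base _) pb       _ (_ , ())
lemma2p4 (base _) (inn ())
lemma2p4 (ser g h) = subsingleton-independent (ser g h) (inn (inj₂ tt)) ser-common-neighbour≡junction
lemma2p4 (par g h) _ _ cx cy (inj₁ (x , y , refl , refl , a)) =
  lemma2p4 g x y (parL-common-neighbour x cx) (parL-common-neighbour y cy) a
lemma2p4 (par g h) _ _ cx cy (inj₂ (x , y , refl , refl , a)) =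
  lemma2p4 h x y (parR-common-neighbour x cx) (parR-common-neighbour y cy) a
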